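{- Let $m\ge 4$ and $3\le t\le m$ be integers. Then for all integers $n\ge \frac{t(t-1)}{2}+m-t$, \[RS_{t,m}(n)=\left\lceil \frac{(t-3)n+\frac{t(t-1)}{2}+m-t}{t-2}\right\rceil.\]
   Context: For $m\ge 3$, $E_m$ denotes the equation $x_1+x_2+\cdots+x_{m-1}=x_m$. For a positive integer $n$, $[1,n]=\{1,2,\ldots,n\}$. An $r$-coloring of a set $S$ is a map $S\to\{1,\ldots,r\}$; it is exact if it is surjective. A solution to $E_m$ in $[1,n]$ is a tuple $(x_1,\ldots,x_m)$ of (not necessarily distinct) elements of $[1,n]$ satisfying $E_m$. For $m\ge 3$ and $2\le t\le m$, the weakened rainbow Schur number $RS_{t,m}(n)$ is the minimum positive integer $r$ such that every exact $r$-coloring of $[1,n]$ admits a solution $(x_1,\ldots,x_m)$ to $E_m$ in $[1,n]$ whose entries $x_1,\ldots,x_m$ receive at least $t$ distinct colors. -}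

module Defs where

open import Data.Nat using (ℕ; zero; suc; _+_; _*_; _∸_; _≤_; _<_)
open import Data.Nat.DivMod using (_/_)
open import Data.Fin using (Fin; inject₁; fromℕ)
open import Data.Vec.Functional using (Vector)
open import Data.Vec.Functional using () renaming (foldr to vfoldr)
open import Data.Product using (Σ; ∃; _×_)
open import Data.Empty using (⊥)
open import Relation.Binary.PropositionalEquality using (_≡_)
open import Relation.Nullary using (¬_)

-- A coloring of [1,n] is a function c : ℕ → ℕ (only values on [1,n] matter).
-- It is an r-coloring if c maps [1,n] into [1,r].
IsColoring : (n r : ℕ) → (ℕ → ℕ) → Set
IsColoring n r c = ∀ x → 1 ≤ x → x ≤ n → (1 ≤ c x) × (c x ≤ r)

IsExactColoring : (n r : ℕ) → (ℕ → ℕ) → Set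
IsExactColoring n r c =
  IsColoring n r c ×
  (∀ k → 1 ≤ k → k ≤ r → Σ ℕ λ x → (1 ≤ x) × (x ≤ n) × (c x ≡ k))

vsum : ∀ {k} → Vector ℕ k → ℕ
vsum = vfoldr _+_ 0

IsSolution : (m n : ℕ) → (Fin m → ℕ) → Set
IsSolution zero    n x = ⊥
IsSolution (suc k) n x =
  (∀ i → (1 ≤ x i) × (x i ≤ n)) ×
  (vsum (λ i → x (inject₁ i)) ≡ x (fromℕ k))

-- the entries of x receive at least t distinct colours under c:
-- there are t positions whose colours are pairwise distinct.
AtLeastColors : (t m : ℕ) → (ℕ → ℕ) → (Fin m → ℕ) → Set
AtLeastColors t m c x =
  Σ (Fin t → Fin m) λ f → ∀ i j → c (x (f i)) ≡ c (x (f j)) → i ≡ j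

Property : (t m n r : ℕ) → Set
Property t m n r =
  ∀ (c : ℕ → ℕ) → IsExactColoring n r c →
    Σ (Fin m → ℕ) λ x → IsSolution m n x × AtLeastColors t m c x

IsRS : (t m n r : ℕ) → Set
IsRS t m n r =
  (1 ≤ r) × Property t m n r × (∀ r' → 1 ≤ r' → r' < r → ¬ Property t m n r')

-- ceiling division ⌈a / b⌉ (b > 0); defined as 0 for b = 0 (never used).
ceilDiv : ℕ → ℕ → ℕ
ceilDiv a zero    = 0
ceilDiv a (suc b) = (a + b) / suc b

-- Write t = 3 + u, m = t + w and a = u n + t(t-1)/2 + w.  For 1 ≤ r ≤ n, every exact r-colouring
-- of [1, n] admits a solution of E_m with t colours iff a ≤ (u + 1) r, so RS_{t,m}(n) = ⌈a / (u + 1)⌉.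
--
-- Lower bound: give [1, n - r + 1] one colour and every larger x a colour of its own.  Among
-- t colours, at least u + 1 belong to summands above n - r + 1, which are then distinct; the
-- other summands are at least 1, so x_m ≥ (u + 1)(n - r + 2) + u(u + 1)/2 + (w + 1), and
-- x_m ≤ n rearranges to a ≤ (u + 1) r.
--
-- Upper bound: call x a first occurrence if no smaller element of [1, n] has its colour.  There
-- are R ≥ r of them and Q = n - R repeats, and a ≤ (u + 1) r gives R ≥ u Q + t(t-1)/2 + w.  The
-- (j+1)-st first occurrence is j + 1 plus the number of repeats below it, so the first few are
-- small.  If w ≥ 1, the t - 1 smallest first occurrences, w - 1 ones and a positive filler sum
-- to the largest first occurrence.  If w = 0, let P be the sum of the t - 2 smallest ones and
-- look above them for a first occurrence z with z + P also a first occurrence.  Were there none,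
-- x ↦ x + P would map the first occurrences in that range into repeats, and counting both
-- contradicts the lower bound on R.
module Submission where

open import Defs
open import Data.Nat.Base
  using (ℕ; zero; suc; _+_; _*_; _∸_; _⊔_; _≤_; _<_; z≤n; s≤s; s≤s⁻¹; pred; >-nonZero)
open import Data.Nat.DivMod using (_/_; _%_; m≡m%n+[m/n]*n; m%n<n; m/n*n≤m; m*n/n≡m)
open import Data.Nat.Properties
open import Data.Nat.Induction using (<-rec)
open import Data.Nat.Tactic.RingSolver using (solve-∀)
open import Data.Fin.Base as Fin
  using (Fin; zero; suc; toℕ; fromℕ; inject₁; punchIn; punchOut; lower₁; _↑ˡ_)
open import Data.Fin.Properties as Fin
  using (toℕ-injective; toℕ-fromℕ; toℕ<n; toℕ-inject₁; inject₁-lower₁; any?;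
         punchIn-injective; punchInᵢ≢i; punchOut-injective; punchIn-punchOut)
open import Data.Vec.Functional
  using (Vector; _∷_; _++_; tail; init; removeAt; insertAt; replicate)
open import Data.Vec.Functional.Properties using (lookup-++ˡ; insertAt-lookup)
open import Data.Vec.Functional.Relation.Unary.All using (All)
open import Data.Vec.Functional.Relation.Unary.All.Properties using (++⁺)
open import Data.Product using (Σ; ∃; _×_; _,_; proj₁; proj₂)
open import Data.Sum using (inj₁; inj₂)
open import Data.Empty using (⊥)
open import Function.Base using (_∘_)
open import Function.Definitions using (Injective)
open import Relation.Binary.PropositionalEquality
open import Relation.Binary.Definitions using (tri<; tri≈; tri>)
open import Relation.Nullary using (¬_; yes; no; ¬?; contradiction)
open import Relation.Nullary.Decidable using (_×-dec_; decidable-stable)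
open import Relation.Unary using (Pred; Decidable)
open import Algebra.Properties.CommutativeMonoid.Sum +-0-commutativeMonoid
  using (sum; sum-syntax; sum-remove; sum-init-last; sum-cong-≗; ∑-distrib-+)

tri : ℕ → ℕ
tri zero    = 0
tri (suc k) = tri k + k

tri[1+n]*2≡[1+n]*n : ∀ n → tri (suc n) * 2 ≡ suc n * n
tri[1+n]*2≡[1+n]*n zero    = refl
tri[1+n]*2≡[1+n]*n (suc n) = begin
  (tri (suc n) + suc n) * 2     ≡⟨ *-distribʳ-+ 2 (tri (suc n)) (suc n) ⟩
  tri (suc n) * 2 + suc n * 2   ≡⟨ cong (_+ suc n * 2) (tri[1+n]*2≡[1+n]*n n) ⟩
  suc n * n + suc n * 2         ≡⟨ regroup n ⟩
  suc (suc n) * suc n           ∎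
  where
  open ≡-Reasoning
  regroup : ∀ n → suc n * n + suc n * 2 ≡ suc (suc n) * suc n
  regroup = solve-∀

tri≡n*[n∸1]/2 : ∀ n → tri n ≡ n * (n ∸ 1) / 2
tri≡n*[n∸1]/2 zero    = refl
tri≡n*[n∸1]/2 (suc n) =
  sym (trans (cong (_/ 2) (sym (tri[1+n]*2≡[1+n]*n n))) (m*n/n≡m (tri (suc n)) 2))

3+n≤tri[3+n] : ∀ n → 3 + n ≤ tri (3 + n)
3+n≤tri[3+n] n = +-monoˡ-≤ (2 + n) (≤-trans (s≤s z≤n) (m≤n+m (suc n) (tri (suc n))))

sum-++ : ∀ {k l} (xs : Vector ℕ k) (ys : Vector ℕ l) → sum (xs ++ ys) ≡ sum xs + sum ys
sum-++ {zero}  xs ys = refl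
sum-++ {suc k} xs ys = begin
  xs zero + sum ((xs ++ ys) ∘ suc)    ≡⟨ cong (xs zero +_) (sum-cong-≗ tail-++) ⟩
  xs zero + sum (tail xs ++ ys)       ≡⟨ cong (xs zero +_) (sum-++ (tail xs) ys) ⟩
  xs zero + (sum (tail xs) + sum ys)  ≡⟨ +-assoc (xs zero) _ _ ⟨
  sum xs + sum ys                     ∎
  where
  open ≡-Reasoning
  tail-++ : ∀ i → (xs ++ ys) (suc i) ≡ (tail xs ++ ys) i
  tail-++ i with Fin.splitAt k i
  ... | inj₁ _ = refl
  ... | inj₂ _ = refl

sum-replicate : ∀ n m → sum (replicate n m) ≡ n * m
sum-replicate zero    m = refl
sum-replicate (suc n) m = cong (m +_) (sum-replicate n m)

∑suc∘toℕ≡tri : ∀ n → ∑[ i < n ] suc (toℕ i) ≡ tri (suc n)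
∑suc∘toℕ≡tri zero    = refl
∑suc∘toℕ≡tri (suc n) = begin
  ∑[ i < suc n ] suc (toℕ i)                               ≡⟨ sum-init-last (λ i → suc (toℕ i)) ⟩
  ∑[ i < n ] suc (toℕ (inject₁ i)) + suc (toℕ (fromℕ n))
    ≡⟨ cong₂ _+_ (sum-cong-≗ {n} (cong suc ∘ toℕ-inject₁)) (cong suc (toℕ-fromℕ n)) ⟩
  ∑[ i < n ] suc (toℕ i) + suc n                           ≡⟨ cong (_+ suc n) (∑suc∘toℕ≡tri n) ⟩
  tri (suc (suc n))                                        ∎
  where open ≡-Reasoning

sum≤n*m : ∀ {n m} (v : Vector ℕ n) → (∀ i → v i ≤ m) → sum v ≤ n * m
sum≤n*m {zero}  v v≤m = z≤n
sum≤n*m {suc n} v v≤m = +-mono-≤ (v≤m zero) (sum≤n*m (tail v) (v≤m ∘ suc))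

n≤sum : ∀ {n} (v : Vector ℕ n) → (∀ i → 1 ≤ v i) → n ≤ sum v
n≤sum {zero}  v 1≤v = z≤n
n≤sum {suc n} v 1≤v = +-mono-≤ (1≤v zero) (n≤sum (tail v) (1≤v ∘ suc))

-- Each of the n ∸ m entries of v that σ misses contributes at least 1.
sum∘σ+[n∸m]≤sum : ∀ {m n} (v : Vector ℕ n) (σ : Fin m → Fin n) → Injective _≡_ _≡_ σ →
                  (∀ i → 1 ≤ v i) → sum (v ∘ σ) + (n ∸ m) ≤ sum v
sum∘σ+[n∸m]≤sum {zero}          v σ σ-inj 1≤v = n≤sum v 1≤v
sum∘σ+[n∸m]≤sum {suc m} {zero}  v σ σ-inj 1≤v with σ zero
... | ()
sum∘σ+[n∸m]≤sum {suc m} {suc n} v σ σ-inj 1≤v = begin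
  v σ₀ + sum (v ∘ σ ∘ suc) + (n ∸ m)                ≡⟨ +-assoc (v σ₀) _ _ ⟩
  v σ₀ + (sum (v ∘ σ ∘ suc) + (n ∸ m))              ≡⟨ cong (λ s → v σ₀ + (s + (n ∸ m))) (sum-cong-≗ σ∘suc≡punchIn∘τ) ⟩
  v σ₀ + (sum (removeAt v σ₀ ∘ τ) + (n ∸ m))
    ≤⟨ +-monoʳ-≤ (v σ₀) (sum∘σ+[n∸m]≤sum (removeAt v σ₀) τ τ-inj (1≤v ∘ punchIn σ₀)) ⟩
  v σ₀ + sum (removeAt v σ₀)                        ≡⟨ sum-remove v ⟨
  sum v                                             ∎
  where
  open ≤-Reasoning
  σ₀ : Fin (suc n)
  σ₀ = σ zero
  σ₀≢σ∘suc : ∀ j → σ₀ ≢ σ (suc j)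
  σ₀≢σ∘suc j eq with σ-inj eq
  ... | ()
  τ : Fin m → Fin n
  τ j = punchOut (σ₀≢σ∘suc j)
  τ-inj : Injective _≡_ _≡_ τ
  τ-inj eq = Fin.suc-injective (σ-inj (punchOut-injective (σ₀≢σ∘suc _) (σ₀≢σ∘suc _) eq))
  σ∘suc≡punchIn∘τ : ∀ j → v (σ (suc j)) ≡ removeAt v σ₀ (τ j)
  σ∘suc≡punchIn∘τ j = cong v (sym (punchIn-punchOut (σ₀≢σ∘suc j)))

minimum-index : ∀ {n} (v : Vector ℕ (suc n)) → ∃ λ i → ∀ j → v i ≤ v j
minimum-index {zero}  v = zero , λ { zero → ≤-refl }
minimum-index {suc n} v with minimum-index (tail v)
... | i , min with v zero ≤? v (suc i)
...   | yes v₀≤ = zero  , λ { zero → ≤-refl ; (suc j) → ≤-trans v₀≤ (min j) }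
...   | no  v₀≰ = suc i , λ { zero → <⇒≤ (≰⇒> v₀≰) ; (suc j) → min j }

-- Remove the minimum: the other entries are distinct and at least m + 1.
injective⇒n*m+tri[n]≤sum : ∀ {n} m (v : Vector ℕ n) → Injective _≡_ _≡_ v →
                           (∀ i → m ≤ v i) → n * m + tri n ≤ sum v
injective⇒n*m+tri[n]≤sum {zero}  m v v-inj m≤v = z≤n
injective⇒n*m+tri[n]≤sum {suc n} m v v-inj m≤v = begin
  suc n * m + tri (suc n)   ≡⟨ regroup n m (tri n) ⟩
  m + (n * suc m + tri n)   ≤⟨ +-mono-≤ (m≤v i) others-bound ⟩
  v i + sum (removeAt v i)  ≡⟨ sum-remove v ⟨
  sum v                     ∎
  where
  open ≤-Reasoning
  regroup : ∀ n m t → suc n * m + (t + n) ≡ m + (n * suc m + t)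
  regroup = solve-∀
  i : Fin (suc n)
  i = proj₁ (minimum-index v)
  others-larger : ∀ j → suc m ≤ removeAt v i j
  others-larger j = ≤-<-trans (m≤v i)
    (≤∧≢⇒< (proj₂ (minimum-index v) (punchIn i j)) (punchInᵢ≢i i j ∘ sym ∘ v-inj))
  others-bound : n * suc m + tri n ≤ sum (removeAt v i)
  others-bound = injective⇒n*m+tri[n]≤sum (suc m) (removeAt v i)
                   (punchIn-injective i _ _ ∘ v-inj) others-larger

injective-∷ : ∀ {n} {a : ℕ} {v : Vector ℕ n} → Injective _≡_ _≡_ v → (∀ i → v i ≢ a) →
              Injective _≡_ _≡_ (a ∷ v)
injective-∷ v-inj a∉v {zero}  {zero}  eq = refl
injective-∷ v-inj a∉v {zero}  {suc j} eq = contradiction (sym eq) (a∉v j)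
injective-∷ v-inj a∉v {suc i} {zero}  eq = contradiction eq (a∉v i)
injective-∷ v-inj a∉v {suc i} {suc j} eq = cong suc (v-inj eq)

∃-injective-avoiding : ∀ {n} (v : Vector ℕ (suc n)) → Injective _≡_ _≡_ v → ∀ a →
                       ∃ λ (τ : Fin n → Fin (suc n)) → Injective _≡_ _≡_ τ × ∀ j → v (τ j) ≢ a
∃-injective-avoiding v v-inj a with any? (λ i → v i ≟ a)
... | yes (i , vᵢ≡a) = punchIn i , punchIn-injective i _ _ ,
                       λ j eq → punchInᵢ≢i i j (v-inj (trans eq (sym vᵢ≡a)))
... | no  a∉v        = suc , Fin.suc-injective , λ j eq → a∉v (suc j , eq)

∃-lowering : ∀ {s k} (ρ : Fin s → Fin (suc k)) → (∀ j → ρ j ≢ fromℕ k) →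
             ∃ λ (σ : Fin s → Fin k) → ∀ j → inject₁ (σ j) ≡ ρ j
∃-lowering {k = k} ρ ρ≢last = (λ j → lower₁ (ρ j) (k≢ j)) , λ j → inject₁-lower₁ (ρ j) (k≢ j)
  where
  k≢ : ∀ j → k ≢ toℕ (ρ j)
  k≢ j eq = ρ≢last j (toℕ-injective (trans (sym eq) (sym (toℕ-fromℕ k))))

-- Of t = s + 2 entries with distinct colours, at most one is the sum x_m and at most one has
-- the colour a, so s of them are summands avoiding a.
∃-colourful-summands : ∀ {s k} c (x : Vector ℕ (suc k)) → AtLeastColors (2 + s) (suc k) c x → ∀ a →
  ∃ λ (σ : Fin s → Fin k) → Injective _≡_ _≡_ (c ∘ init x ∘ σ) × ∀ j → c (init x (σ j)) ≢ a
∃-colourful-summands {s} {k} c x (f , f-inj) a =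
  let τ₁ , τ₁-inj , τ₁≢last = ∃-injective-avoiding (c ∘ x ∘ f) (f-inj _ _) (c (x (fromℕ k)))
      τ₂ , τ₂-inj , τ₂≢a    = ∃-injective-avoiding (c ∘ x ∘ f ∘ τ₁) (τ₁-inj ∘ f-inj _ _) a
      σ , inject₁∘σ≡        = ∃-lowering (f ∘ τ₁ ∘ τ₂) (λ j eq → τ₁≢last (τ₂ j) (cong (c ∘ x) eq))
      colour : ∀ j → c (init x (σ j)) ≡ c (x (f (τ₁ (τ₂ j))))
      colour j = cong (c ∘ x) (inject₁∘σ≡ j)
  in σ , (λ {i} {j} eq → τ₂-inj (τ₁-inj (f-inj _ _ (trans (sym (colour i)) (trans eq (colour j)))))) ,
     λ j eq → τ₂≢a j (trans (sym (colour j)) eq)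

insertAt-fromℕ-inject₁ : ∀ {k} (v : Vector ℕ k) a i → insertAt v (fromℕ k) a (inject₁ i) ≡ v i
insertAt-fromℕ-inject₁ v a zero    = refl
insertAt-fromℕ-inject₁ v a (suc i) = insertAt-fromℕ-inject₁ (tail v) a i

insertAt⁺ : ∀ {p} {P : Pred ℕ p} {k} (v : Vector ℕ k) i a → All P v → P a → All P (insertAt v i a)
insertAt⁺             v zero    a Pv Pa zero    = Pa
insertAt⁺             v zero    a Pv Pa (suc j) = Pv j
insertAt⁺ {k = suc k} v (suc i) a Pv Pa zero    = Pv zero
insertAt⁺ {k = suc k} v (suc i) a Pv Pa (suc j) = insertAt⁺ (tail v) i a (Pv ∘ suc) Pa j

insertAt-fromℕ-IsSolution : ∀ {k n} (v : Vector ℕ k) s →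
  All (λ y → 1 ≤ y × y ≤ n) v → 1 ≤ s × s ≤ n → sum v ≡ s →
  IsSolution (suc k) n (insertAt v (fromℕ k) s)
insertAt-fromℕ-IsSolution {k} v s v-range s-range sum≡s =
  insertAt⁺ v (fromℕ k) s v-range s-range ,
  trans (sum-cong-≗ (insertAt-fromℕ-inject₁ v s)) (trans sum≡s (sym (insertAt-lookup v (fromℕ k) s)))

solution-bound : ∀ {s k n} m (x : Vector ℕ (suc k)) → IsSolution (suc k) n x →
  (σ : Fin s → Fin k) → Injective _≡_ _≡_ (init x ∘ σ) → (∀ j → m ≤ init x (σ j)) →
  s * m + tri s + (k ∸ s) ≤ n
solution-bound {s} {k} {n} m x (range , sum≡last) σ values-inj m≤values = begin
  s * m + tri s + (k ∸ s)     ≤⟨ +-monoˡ-≤ (k ∸ s) (injective⇒n*m+tri[n]≤sum m (init x ∘ σ) values-inj m≤values) ⟩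
  sum (init x ∘ σ) + (k ∸ s)  ≤⟨ sum∘σ+[n∸m]≤sum (init x) σ σ-inj (proj₁ ∘ range ∘ inject₁) ⟩
  sum (init x)                ≡⟨ sum≡last ⟩
  x (fromℕ k)                 ≤⟨ proj₂ (range (fromℕ k)) ⟩
  n                           ∎
  where
  open ≤-Reasoning
  σ-inj : Injective _≡_ _≡_ σ
  σ-inj eq = values-inj (cong (init x) eq)

count : ∀ {p} {P : Pred ℕ p} → Decidable P → ℕ → ℕ
count P? zero = 0
count P? (suc x) with P? (suc x)
... | yes _ = suc (count P? x)
... | no  _ = count P? x

module _ {p} {P : Pred ℕ p} (P? : Decidable P) where

  count-suc : ∀ x → P (suc x) → count P? (suc x) ≡ suc (count P? x)
  count-suc x Px with P? (suc x)
  ... | yes _   = refl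
  ... | no  ¬Px = contradiction Px ¬Px

  count-suc-≤ : ∀ x → count P? (suc x) ≤ suc (count P? x)
  count-suc-≤ x with P? (suc x)
  ... | yes _ = ≤-refl
  ... | no  _ = n≤1+n _

  count-≤-suc : ∀ x → count P? x ≤ count P? (suc x)
  count-≤-suc x with P? (suc x)
  ... | yes _ = n≤1+n _
  ... | no  _ = ≤-refl

  count-mono : ∀ {x y} → x ≤ y → count P? x ≤ count P? y
  count-mono x≤y with m≤n⇒m<n∨m≡n x≤y
  ... | inj₁ (s≤s x≤y′) = ≤-trans (count-mono x≤y′) (count-≤-suc _)
  ... | inj₂ refl       = ≤-refl

  count-< : ∀ {x y} → x < y → P y → count P? x < count P? y
  count-< {x} {suc y} (s≤s x≤y) Py = begin-strict
    count P? x        ≤⟨ count-mono x≤y ⟩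
    count P? y        <⟨ n<1+n _ ⟩
    suc (count P? y)  ≡⟨ count-suc y Py ⟨
    count P? (suc y)  ∎
    where open ≤-Reasoning

  count-injective : ∀ {x y} → P x → P y → count P? x ≡ count P? y → x ≡ y
  count-injective {x} {y} Px Py eq with <-cmp x y
  ... | tri< x<y _ _ = contradiction eq (<⇒≢ (count-< x<y Py))
  ... | tri≈ _ x≡y _ = x≡y
  ... | tri> _ _ y<x = contradiction (sym eq) (<⇒≢ (count-< y<x Px))

  count+count¬≡n : ∀ x → count P? x + count (¬? ∘ P?) x ≡ x
  count+count¬≡n zero = refl
  count+count¬≡n (suc x) with P? (suc x)
  ... | yes _ = cong suc (count+count¬≡n x)
  ... | no  _ = trans (+-suc _ _) (cong suc (count+count¬≡n x))

  count[d+x]≤d+count[x] : ∀ d x → count P? (d + x) ≤ d + count P? x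
  count[d+x]≤d+count[x] zero    x = ≤-refl
  count[d+x]≤d+count[x] (suc d) x = ≤-trans (count-suc-≤ (d + x)) (s≤s (count[d+x]≤d+count[x] d x))

  count-enumerate : ∀ x j → j < count P? x → ∃ λ y → y ≤ x × P y × count P? y ≡ suc j
  count-enumerate (suc x) j j<count with P? (suc x)
  count-enumerate (suc x) j j<count | no _ =
    let y , y≤x , Py , count≡ = count-enumerate x j j<count in y , m≤n⇒m≤1+n y≤x , Py , count≡
  count-enumerate (suc x) j j<count | yes Px with j <? count P? x
  ... | yes j<count′ =
    let y , y≤x , Py , count≡ = count-enumerate x j j<count′ in y , m≤n⇒m≤1+n y≤x , Py , count≡
  ... | no  j≮count′ = suc x , ≤-refl , Px ,
    trans (count-suc x Px) (cong suc (≤-antisym (≮⇒≥ j≮count′) (s≤s⁻¹ j<count)))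

  injective⇒≤count : ∀ {r} x (g : Fin r → ℕ) → Injective _≡_ _≡_ g →
                     All (λ y → P y × 1 ≤ y × y ≤ x) g → r ≤ count P? x
  injective⇒≤count {zero}  x       g g-inj g-ok = z≤n
  injective⇒≤count {suc r} zero    g g-inj g-ok =
    let _ , 1≤g₀ , g₀≤0 = g-ok zero in contradiction g₀≤0 (<⇒≱ 1≤g₀)
  injective⇒≤count {suc r} (suc x) g g-inj g-ok with any? (λ i → g i ≟ suc x)
  ... | yes (i , gᵢ≡1+x) = begin
    suc r             ≤⟨ s≤s (injective⇒≤count x (g ∘ punchIn i) (punchIn-injective i _ _ ∘ g-inj) others-ok) ⟩
    suc (count P? x)  ≡⟨ count-suc x (subst P gᵢ≡1+x (proj₁ (g-ok i))) ⟨
    count P? (suc x)  ∎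
    where
    open ≤-Reasoning
    others-ok : All (λ y → P y × 1 ≤ y × y ≤ x) (g ∘ punchIn i)
    others-ok j = let Pg , 1≤g , g≤1+x = g-ok (punchIn i j) in
      Pg , 1≤g , s≤s⁻¹ (≤∧≢⇒< g≤1+x λ eq → punchInᵢ≢i i j (g-inj (trans eq (sym gᵢ≡1+x))))
  ... | no  1+x∉g = ≤-trans (injective⇒≤count x g g-inj g-ok′) (count-≤-suc x)
    where
    g-ok′ : All (λ y → P y × 1 ≤ y × y ≤ x) g
    g-ok′ i = let Pg , 1≤g , g≤1+x = g-ok i in
      Pg , 1≤g , s≤s⁻¹ (≤∧≢⇒< g≤1+x λ eq → 1+x∉g (i , eq))

-- If y ↦ y + d maps the P-elements of (a, L + a] to Q-elements, there are at most as many of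
-- the former as Q-elements in (a + d, L + a + d].
count-shift : ∀ {p q} {P : Pred ℕ p} {Q : Pred ℕ q} (P? : Decidable P) (Q? : Decidable Q) a d L →
              (∀ y → a < y → y ≤ L + a → P y → Q (y + d)) →
              count P? (L + a) + count Q? (a + d) ≤ count Q? (L + a + d) + count P? a
count-shift P? Q? a d zero    P⇒Q = ≤-reflexive (+-comm (count P? a) _)
count-shift {Q = Q} P? Q? a d (suc L) P⇒Q
  with P? (suc (L + a)) | count-shift P? Q? a d L (λ y a<y y≤L+a → P⇒Q y a<y (m≤n⇒m≤1+n y≤L+a))
... | yes Py | previous = begin
  suc (count P? (L + a) + count Q? (a + d))       ≤⟨ s≤s previous ⟩
  suc (count Q? (L + a + d)) + count P? a         ≡⟨ cong (_+ count P? a) (count-suc Q? (L + a + d) Q[1+L+a+d]) ⟨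
  count Q? (suc (L + a + d)) + count P? a         ∎
  where
  open ≤-Reasoning
  Q[1+L+a+d] : Q (suc (L + a + d))
  Q[1+L+a+d] = P⇒Q (suc (L + a)) (s≤s (m≤n+m a L)) ≤-refl Py
... | no  _  | previous = ≤-trans previous (+-monoˡ-≤ (count P? a) (count-≤-suc Q? (L + a + d)))

staircase : ℕ → ℕ → ℕ
staircase e x = 1 ⊔ (x ∸ e)

staircase-exact : ∀ e r → 1 ≤ r → IsExactColoring (r + e) r (staircase e)
staircase-exact e r 1≤r = colouring , surjective
  where
  colouring : IsColoring (r + e) r (staircase e)
  colouring x 1≤x x≤r+e =
    m≤m⊔n 1 (x ∸ e) , ⊔-lub 1≤r (m≤n+o⇒m∸n≤o x e (subst (x ≤_) (+-comm r e) x≤r+e))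
  surjective : ∀ k → 1 ≤ k → k ≤ r → Σ ℕ λ x → 1 ≤ x × x ≤ r + e × staircase e x ≡ k
  surjective k 1≤k k≤r =
    k + e , ≤-trans 1≤k (m≤m+n k e) , +-monoˡ-≤ e k≤r ,
    trans (cong (1 ⊔_) (m+n∸n≡m k e)) (m≤n⇒m⊔n≡n 1≤k)

staircase≢1⇒2+e≤ : ∀ e x → staircase e x ≢ 1 → 2 + e ≤ x
staircase≢1⇒2+e≤ e x colour≢1 = ≮⇒≥ λ x<2+e →
  colour≢1 (m≥n⇒m⊔n≡m (m≤n+o⇒m∸n≤o x e (subst (x ≤_) (+-comm 1 e) (s≤s⁻¹ x<2+e))))

staircase-arithmetic : ∀ u e r w → suc u * (2 + e) + tri (suc u) + suc w ≤ r + e →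
                       u * (r + e) + tri (3 + u) + w ≤ suc u * r
staircase-arithmetic u e r w bound = begin
  u * (r + e) + tri (3 + u) + w      ≡⟨ regroup₁ u r e (tri (suc u)) w ⟩
  u * r + (u * e + tri (3 + u) + w)  ≤⟨ +-monoʳ-≤ (u * r) excess≤r ⟩
  u * r + r                          ≡⟨ +-comm (u * r) r ⟩
  suc u * r                          ∎
  where
  open ≤-Reasoning
  regroup₁ : ∀ u r e t w → u * (r + e) + (t + suc u + suc (suc u)) + w ≡
                           u * r + (u * e + (t + suc u + suc (suc u)) + w)
  regroup₁ = solve-∀
  regroup₂ : ∀ u e t w → suc u * (2 + e) + t + suc w ≡ e + (u * e + (t + suc u + suc (suc u)) + w)
  regroup₂ = solve-∀
  excess≤r : u * e + tri (3 + u) + w ≤ r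
  excess≤r = +-cancelˡ-≤ e _ _ (subst₂ _≤_ (regroup₂ u e (tri (suc u)) w) (+-comm r e) bound)

staircase-bound : ∀ u w r e → 1 ≤ r → Property (3 + u) (3 + u + w) (r + e) r →
                  u * (r + e) + tri (3 + u) + w ≤ suc u * r
staircase-bound u w r e 1≤r property with property (staircase e) (staircase-exact e r 1≤r)
... | x , solution , colourful = bound (∃-colourful-summands (staircase e) x colourful 1)
  where
  k : ℕ
  k = 2 + u + w
  k∸[1+u]≡1+w : k ∸ suc u ≡ suc w
  k∸[1+u]≡1+w = trans (cong (_∸ u) (sym (+-suc u w))) (m+n∸m≡n u (suc w))
  bound : (∃ λ (σ : Fin (suc u) → Fin k) → Injective _≡_ _≡_ (staircase e ∘ init x ∘ σ) ×
                                            ∀ j → staircase e (init x (σ j)) ≢ 1) →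
          u * (r + e) + tri (3 + u) + w ≤ suc u * r
  bound (σ , colours-inj , colour≢1) = staircase-arithmetic u e r w
    (subst (λ d → suc u * (2 + e) + tri (suc u) + d ≤ r + e) k∸[1+u]≡1+w
      (solution-bound (2 + e) x solution σ (λ eq → colours-inj (cong (staircase e) eq))
        (λ j → staircase≢1⇒2+e≤ e (init x (σ j)) (colour≢1 j))))

module FirstOccurrences (c : ℕ → ℕ) where

  First : Pred ℕ _
  First x = ¬ ∃ λ y → y < x × 1 ≤ y × c y ≡ c x

  First? : Decidable First
  First? x = ¬? (anyUpTo? (λ y → 1 ≤? y ×-dec c y ≟ c x) x)

  first-1 : First 1
  first-1 (y , s≤s y≤0 , 1≤y , _) = contradiction (≤-trans 1≤y y≤0) λ ()

  ∃-first : ∀ x → 1 ≤ x → ∃ λ y → First y × 1 ≤ y × y ≤ x × c y ≡ c x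
  ∃-first = <-rec _ step
    where
    step : ∀ x → (∀ {y} → y < x → 1 ≤ y → ∃ λ z → First z × 1 ≤ z × z ≤ y × c z ≡ c y) →
           1 ≤ x → ∃ λ y → First y × 1 ≤ y × y ≤ x × c y ≡ c x
    step x earlier 1≤x with anyUpTo? (λ y → 1 ≤? y ×-dec c y ≟ c x) x
    ... | no  none                    = x , none , 1≤x , ≤-refl , refl
    ... | yes (y , y<x , 1≤y , cy≡cx) =
      let z , Fz , 1≤z , z≤y , cz≡cy = earlier y<x 1≤y in
      z , Fz , 1≤z , ≤-trans z≤y (<⇒≤ y<x) , trans cz≡cy cy≡cx

  first-colour-injective : ∀ {x y} → First x → First y → 1 ≤ x → 1 ≤ y → c x ≡ c y → x ≡ y
  first-colour-injective {x} {y} Fx Fy 1≤x 1≤y cx≡cy with <-cmp x y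
  ... | tri< x<y _ _ = contradiction (x , x<y , 1≤x , cx≡cy) Fy
  ... | tri≈ _ x≡y _ = x≡y
  ... | tri> _ _ y<x = contradiction (y , y<x , 1≤y , sym cx≡cy) Fx

  colours≤firsts : ∀ {n r} → IsExactColoring n r c → r ≤ count First? n
  colours≤firsts {n} {r} (_ , surjective) =
    injective⇒≤count First? n (proj₁ ∘ first-of) first-of-inj (proj₁ ∘ proj₂ ∘ first-of)
    where
    first-of : (i : Fin r) → ∃ λ y → (First y × 1 ≤ y × y ≤ n) × c y ≡ suc (toℕ i)
    first-of i =
      let x , 1≤x , x≤n , cx≡i = surjective (suc (toℕ i)) (s≤s z≤n) (toℕ<n i)
          y , Fy , 1≤y , y≤x , cy≡cx = ∃-first x 1≤x
      in y , (Fy , 1≤y , ≤-trans y≤x x≤n) , trans cy≡cx cx≡i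
    first-of-inj : Injective _≡_ _≡_ (proj₁ ∘ first-of)
    first-of-inj {i} {j} eq = toℕ-injective (suc-injective
      (trans (sym (proj₂ (proj₂ (first-of i)))) (trans (cong c eq) (proj₂ (proj₂ (first-of j))))))

  insertAt-fromℕ-colourful : ∀ {t k} (v : Vector ℕ k) s (g : Fin t → Fin k) (w : Vector ℕ t) →
    (∀ i → v (g i) ≡ w i) → Injective _≡_ _≡_ (s ∷ w) → All (λ y → First y × 1 ≤ y) (s ∷ w) →
    AtLeastColors (suc t) (suc k) c (insertAt v (fromℕ k) s)
  insertAt-fromℕ-colourful {t} {k} v s g w v∘g≡w s∷w-inj firsts = f , colours-inj
    where
    f : Fin (suc t) → Fin (suc k)
    f = fromℕ k ∷ inject₁ ∘ g
    entry : ∀ i → insertAt v (fromℕ k) s (f i) ≡ (s ∷ w) i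
    entry zero    = insertAt-lookup v (fromℕ k) s
    entry (suc i) = trans (insertAt-fromℕ-inject₁ v s (g i)) (v∘g≡w i)
    colours-inj : ∀ i j → c (insertAt v (fromℕ k) s (f i)) ≡ c (insertAt v (fromℕ k) s (f j)) → i ≡ j
    colours-inj i j eq = s∷w-inj (first-colour-injective (proj₁ (firsts i)) (proj₁ (firsts j))
      (proj₂ (firsts i)) (proj₂ (firsts j)) (trans (cong c (sym (entry i))) (trans eq (cong c (entry j)))))

a+P≤R+Q : ∀ u p P Q R → P ≤ tri (2 + u) + u * p → u * Q + tri (3 + u) ≤ R → p ≤ Q →
          suc u + p + P ≤ R + Q
a+P≤R+Q u p P Q R P≤ enough p≤Q = begin
  suc u + p + P                            ≤⟨ +-monoʳ-≤ (suc u + p) P≤ ⟩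
  suc u + p + (tri (2 + u) + u * p)        ≡⟨ regroup₁ u p (tri (2 + u)) ⟩
  suc u + (tri (2 + u) + suc u * p)
    ≤⟨ +-mono-≤ (n≤1+n (suc u)) (+-monoʳ-≤ (tri (2 + u)) (*-monoʳ-≤ (suc u) p≤Q)) ⟩
  suc (suc u) + (tri (2 + u) + suc u * Q)  ≡⟨ regroup₂ u Q (tri (2 + u)) ⟩
  u * Q + tri (3 + u) + Q                  ≤⟨ +-monoˡ-≤ Q enough ⟩
  R + Q                                    ∎
  where
  open ≤-Reasoning
  regroup₁ : ∀ u p t → suc u + p + (t + u * p) ≡ suc u + (t + suc u * p)
  regroup₁ = solve-∀
  regroup₂ : ∀ u Q t → suc (suc u) + (t + suc u * Q) ≡ u * Q + (t + suc (suc u)) + Q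
  regroup₂ = solve-∀

no-gap-arithmetic : ∀ u p P Q R → 1 ≤ u → R + p ≤ Q + suc u + P → P ≤ tri (2 + u) + u * p →
                    u * Q + tri (3 + u) ≤ R → p ≤ Q → ⊥
no-gap-arithmetic (suc u) p P Q R _ R+p≤ P≤ enough p≤Q = 1+n≰n (begin-strict
  u * Q + X                          <⟨ n<1+n _ ⟩
  suc (u * Q + X)                    ≡⟨ regroup₁ u Q p t ⟩
  suc u * Q + tri (4 + u) + p        ≤⟨ +-monoˡ-≤ p enough ⟩
  R + p                              ≤⟨ R+p≤ ⟩
  Q + suc (suc u) + P                ≤⟨ +-monoʳ-≤ (Q + suc (suc u)) P≤ ⟩
  Q + suc (suc u) + (t + suc u * p)  ≡⟨ regroup₂ u Q p t ⟩
  u * p + X                          ≤⟨ +-monoˡ-≤ X (*-monoʳ-≤ u p≤Q) ⟩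
  u * Q + X                          ∎)
  where
  open ≤-Reasoning
  t X : ℕ
  t = tri (3 + u)
  X = Q + t + suc (suc u) + p
  regroup₁ : ∀ u Q p t → suc (u * Q + (Q + t + suc (suc u) + p)) ≡ suc u * Q + (t + suc (suc (suc u))) + p
  regroup₁ = solve-∀
  regroup₂ : ∀ u Q p t → Q + suc (suc u) + (t + suc u * p) ≡ u * p + (Q + t + suc (suc u) + p)
  regroup₂ = solve-∀

module UpperBound (c : ℕ → ℕ) (n : ℕ) where
  open FirstOccurrences c

  repeats : ℕ → ℕ
  repeats = count (¬? ∘ First?)

  R Q : ℕ
  R = count First? n
  Q = repeats n

  capacity : ∀ {r} u X → IsExactColoring n r c → u * n + X ≤ suc u * r → u * Q + X ≤ R
  capacity {r} u X exact a≤[1+u]r = +-cancelˡ-≤ (u * R) _ _ (begin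
    u * R + (u * Q + X)  ≡⟨ regroup u R Q X ⟩
    u * (R + Q) + X      ≡⟨ cong (λ m → u * m + X) (count+count¬≡n First? n) ⟩
    u * n + X            ≤⟨ a≤[1+u]r ⟩
    suc u * r            ≤⟨ *-monoʳ-≤ (suc u) (colours≤firsts exact) ⟩
    suc u * R            ≡⟨ +-comm R (u * R) ⟩
    u * R + R            ∎)
    where
    open ≤-Reasoning
    regroup : ∀ u R Q X → u * R + (u * Q + X) ≡ u * (R + Q) + X
    regroup = solve-∀

  nth : ∀ j → j < R → ℕ
  nth j j<R = proj₁ (count-enumerate First? n j j<R)

  module _ {j} (j<R : j < R) where

    nth≤n : nth j j<R ≤ n
    nth≤n = proj₁ (proj₂ (count-enumerate First? n j j<R))

    nth-first : First (nth j j<R)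
    nth-first = proj₁ (proj₂ (proj₂ (count-enumerate First? n j j<R)))

    count-nth : count First? (nth j j<R) ≡ suc j
    count-nth = proj₂ (proj₂ (proj₂ (count-enumerate First? n j j<R)))

    nth≡1+j+repeats : nth j j<R ≡ suc j + repeats (nth j j<R)
    nth≡1+j+repeats = trans (sym (count+count¬≡n First? _)) (cong (_+ repeats (nth j j<R)) count-nth)

    1≤nth : 1 ≤ nth j j<R
    1≤nth = subst (1 ≤_) (sym nth≡1+j+repeats) (s≤s z≤n)

  nth-mono-< : ∀ {i j} (i<R : i < R) (j<R : j < R) → i < j → nth i i<R < nth j j<R
  nth-mono-< i<R j<R i<j = ≰⇒> λ nthⱼ≤nthᵢ →
    <⇒≱ (s≤s i<j) (subst₂ _≤_ (count-nth j<R) (count-nth i<R) (count-mono First? nthⱼ≤nthᵢ))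

  nth-mono-≤ : ∀ {i j} (i<R : i < R) (j<R : j < R) → i ≤ j → nth i i<R ≤ nth j j<R
  nth-mono-≤ i<R j<R i≤j = ≮⇒≥ λ nthⱼ<nthᵢ →
    <⇒≱ (subst₂ _<_ (count-nth j<R) (count-nth i<R) (count-< First? nthⱼ<nthᵢ (nth-first i<R))) (s≤s i≤j)

  nth-0≡1 : (0<R : 0 < R) → nth 0 0<R ≡ 1
  nth-0≡1 0<R = count-injective First? (nth-first 0<R) first-1
    (trans (count-nth 0<R) (sym (count-suc First? 0 first-1)))

  prefix : ∀ {s} → s ≤ R → Vector ℕ s
  prefix s≤R i = nth (toℕ i) (<-≤-trans (toℕ<n i) s≤R)

  prefix-injective : ∀ {s} (s≤R : s ≤ R) → Injective _≡_ _≡_ (prefix s≤R)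
  prefix-injective s≤R {i} {j} eq with <-cmp (toℕ i) (toℕ j)
  ... | tri< i<j _ _ = contradiction eq (<⇒≢ (nth-mono-< _ _ i<j))
  ... | tri≈ _ i≡j _ = toℕ-injective i≡j
  ... | tri> _ _ j<i = contradiction (sym eq) (<⇒≢ (nth-mono-< _ _ j<i))

  prefix-first : ∀ {s} (s≤R : s ≤ R) → All (λ y → First y × 1 ≤ y) (prefix s≤R)
  prefix-first s≤R i = nth-first _ , 1≤nth _

  prefix-range : ∀ {s} (s≤R : s ≤ R) → All (λ y → 1 ≤ y × y ≤ n) (prefix s≤R)
  prefix-range s≤R i = 1≤nth _ , nth≤n _

  -- The first entry is 1, which has no repeats below it.
  sum-prefix : ∀ {s} (s<R : s < R) → sum (prefix s<R) ≤ tri (2 + s) + s * repeats (nth s s<R)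
  sum-prefix {s} s<R = begin
    sum (prefix s<R)                                        ≡⟨ sum-cong-≗ (nth≡1+j+repeats ∘ bound) ⟩
    ∑[ i < suc s ] (suc (toℕ i) + repeats (prefix s<R i))   ≡⟨ ∑-distrib-+ (suc ∘ toℕ) (repeats ∘ prefix s<R) ⟩
    ∑[ i < suc s ] suc (toℕ i) + sum (repeats ∘ prefix s<R) ≡⟨ cong₂ _+_ (∑suc∘toℕ≡tri (suc s)) first-repeats≡0 ⟩
    tri (2 + s) + sum (repeats ∘ prefix s<R ∘ suc)          ≤⟨ +-monoʳ-≤ (tri (2 + s)) (sum≤n*m _ later-repeats) ⟩
    tri (2 + s) + s * repeats (nth s s<R)                   ∎
    where
    open ≤-Reasoning
    bound : (i : Fin (suc s)) → toℕ i < R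
    bound i = <-≤-trans (toℕ<n i) s<R
    first-repeats≡0 : repeats (prefix s<R zero) + sum (repeats ∘ prefix s<R ∘ suc) ≡
                      sum (repeats ∘ prefix s<R ∘ suc)
    first-repeats≡0 = cong (_+ sum (repeats ∘ prefix s<R ∘ suc))
      (suc-injective (trans (sym (nth≡1+j+repeats (bound zero))) (nth-0≡1 (bound zero))))
    later-repeats : ∀ i → repeats (prefix s<R (suc i)) ≤ repeats (nth s s<R)
    later-repeats i = count-mono (¬? ∘ First?) (nth-mono-≤ (bound (suc i)) s<R (toℕ<n i))

  -- w ≥ 1: the t - 1 smallest first occurrences, a filler y and w - 1 ones sum to the largest one.
  module Case-m>t {r} (u w : ℕ) (exact : IsExactColoring n r c)
                  (a≤[1+u]r : u * n + tri (3 + u) + suc w ≤ suc u * r) where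

    T : ℕ
    T = tri (3 + u)

    enough : u * Q + (T + suc w) ≤ R
    enough = capacity u (T + suc w) exact (subst (_≤ suc u * r) (+-assoc (u * n) T (suc w)) a≤[1+u]r)

    3+u≤R : 3 + u ≤ R
    3+u≤R = ≤-trans (3+n≤tri[3+n] u) (≤-trans (m≤m+n T (suc w)) (≤-trans (m≤n+m (T + suc w) (u * Q)) enough))

    2+u≤R : 2 + u ≤ R
    2+u≤R = ≤-trans (n≤1+n (2 + u)) 3+u≤R

    β : Vector ℕ (2 + u)
    β = prefix 2+u≤R

    p : ℕ
    p = repeats (nth (suc u) 2+u≤R)

    1+ℓ≡R : suc (pred R) ≡ R
    1+ℓ≡R = suc-pred R {{>-nonZero (≤-trans (s≤s z≤n) 3+u≤R)}}

    ℓ<R : pred R < R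
    ℓ<R = ≤-reflexive 1+ℓ≡R

    D : ℕ
    D = nth (pred R) ℓ<R

    β<D : ∀ i → β i < D
    β<D i = nth-mono-< _ ℓ<R (<-≤-trans (toℕ<n i) (<⇒≤pred 3+u≤R))

    sum-β+w<D : sum β + suc w ≤ D
    sum-β+w<D = begin
      sum β + suc w             ≤⟨ +-monoˡ-≤ (suc w) (sum-prefix 2+u≤R) ⟩
      T + suc u * p + suc w     ≡⟨ regroup T u p (suc w) ⟩
      u * p + (T + suc w) + p   ≤⟨ +-monoˡ-≤ p (+-monoˡ-≤ (T + suc w) (*-monoʳ-≤ u p≤Q)) ⟩
      u * Q + (T + suc w) + p   ≤⟨ +-mono-≤ enough p≤repeats[D] ⟩
      R + repeats D             ≡⟨ cong (_+ repeats D) 1+ℓ≡R ⟨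
      suc (pred R) + repeats D  ≡⟨ nth≡1+j+repeats ℓ<R ⟨
      D                         ∎
      where
      open ≤-Reasoning
      regroup : ∀ T u p w → T + suc u * p + w ≡ u * p + (T + w) + p
      regroup = solve-∀
      p≤Q : p ≤ Q
      p≤Q = count-mono (¬? ∘ First?) (nth≤n 2+u≤R)
      p≤repeats[D] : p ≤ repeats D
      p≤repeats[D] = count-mono (¬? ∘ First?) (nth-mono-≤ 2+u≤R ℓ<R (<⇒≤pred 2+u≤R))

    y : ℕ
    y = D ∸ (sum β + w)

    summands : Vector ℕ (2 + u + suc w)
    summands = β ++ (y ∷ replicate w 1)

    sum≡D : sum summands ≡ D
    sum≡D = begin
      sum summands                       ≡⟨ sum-++ β (y ∷ replicate w 1) ⟩
      sum β + (y + sum (replicate w 1))  ≡⟨ cong (λ s → sum β + (y + s)) (trans (sum-replicate w 1) (*-identityʳ w)) ⟩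
      sum β + (y + w)                    ≡⟨ cong (sum β +_) (+-comm y w) ⟩
      sum β + (w + y)                    ≡⟨ +-assoc (sum β) w y ⟨
      sum β + w + y                      ≡⟨ m+[n∸m]≡n (≤-trans (+-monoʳ-≤ (sum β) (n≤1+n w)) sum-β+w<D) ⟩
      D                                  ∎
      where open ≡-Reasoning

    summands-range : All (λ x → 1 ≤ x × x ≤ n) summands
    summands-range = ++⁺ (λ x → 1 ≤ x × x ≤ n) (prefix-range 2+u≤R) λ
      { zero    → m<n⇒0<n∸m (subst (_≤ D) (+-suc (sum β) w) sum-β+w<D) ,
                  ≤-trans (m∸n≤m D (sum β + w)) (nth≤n ℓ<R)
      ; (suc i) → ≤-refl , ≤-trans (1≤nth ℓ<R) (nth≤n ℓ<R) }

    solution : Σ (Fin (3 + u + suc w) → ℕ) λ x →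
               IsSolution (3 + u + suc w) n x × AtLeastColors (3 + u) (3 + u + suc w) c x
    solution =
      insertAt summands (fromℕ (2 + u + suc w)) D ,
      insertAt-fromℕ-IsSolution summands D summands-range (1≤nth ℓ<R , nth≤n ℓ<R) sum≡D ,
      insertAt-fromℕ-colourful summands D (_↑ˡ suc w) β (lookup-++ˡ β (y ∷ replicate w 1))
        (injective-∷ (prefix-injective 2+u≤R) (λ i → <⇒≢ (β<D i)))
        λ { zero → nth-first ℓ<R , 1≤nth ℓ<R ; (suc i) → prefix-first 2+u≤R i }

  -- w = 0: with P the sum of the t - 2 smallest first occurrences and a the largest of them,
  -- look for a first occurrence z > a such that z + P is one as well.
  module Case-m≡t {r} (u : ℕ) (1≤u : 1 ≤ u) (exact : IsExactColoring n r c)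
                  (a≤[1+u]r : u * n + tri (3 + u) ≤ suc u * r) where

    enough : u * Q + tri (3 + u) ≤ R
    enough = capacity u (tri (3 + u)) exact a≤[1+u]r

    1+u≤R : suc u ≤ R
    1+u≤R = ≤-trans (m≤n+m (suc u) 2) (≤-trans (3+n≤tri[3+n] u) (≤-trans (m≤n+m (tri (3 + u)) (u * Q)) enough))

    β : Vector ℕ (suc u)
    β = prefix 1+u≤R

    a p P : ℕ
    a = nth u 1+u≤R
    p = repeats a
    P = sum β

    β≤a : ∀ i → β i ≤ a
    β≤a i = nth-mono-≤ _ 1+u≤R (s≤s⁻¹ (toℕ<n i))

    1≤P : 1 ≤ P
    1≤P = ≤-trans (1≤nth _) (m≤m+n (β zero) (sum (β ∘ suc)))

    Gap : Pred ℕ _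
    Gap z = a < z × z + P ≤ n × First z × First (z + P)

    gap? : Decidable Gap
    gap? z = a <? z ×-dec z + P ≤? n ×-dec First? z ×-dec First? (z + P)

    gap-not-absent : ¬ ¬ ∃ λ z → z < suc n × Gap z
    gap-not-absent none = no-gap-arithmetic u p P Q R 1≤u R+p≤ (sum-prefix 1+u≤R) enough p≤Q
      where
      open ≤-Reasoning
      p≤Q : p ≤ Q
      p≤Q = count-mono (¬? ∘ First?) (nth≤n 1+u≤R)
      a+P≤n : a + P ≤ n
      a+P≤n = subst₂ _≤_ (cong (_+ P) (sym (nth≡1+j+repeats 1+u≤R))) (count+count¬≡n First? n)
                (a+P≤R+Q u p P Q R (sum-prefix 1+u≤R) enough p≤Q)
      L : ℕ
      L = n ∸ (a + P)
      L+a+P≡n : L + a + P ≡ n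
      L+a+P≡n = trans (+-assoc L a P) (trans (+-comm L (a + P)) (m+[n∸m]≡n a+P≤n))
      first⇒repeat : ∀ y → a < y → y ≤ L + a → First y → ¬ First (y + P)
      first⇒repeat y a<y y≤L+a Fy Fy+P = none (y , s≤s (≤-trans (m≤m+n y P) y+P≤n) , a<y , y+P≤n , Fy , Fy+P)
        where
        y+P≤n : y + P ≤ n
        y+P≤n = subst (y + P ≤_) L+a+P≡n (+-monoˡ-≤ P y≤L+a)
      shifted : count First? (L + a) + repeats (a + P) ≤ Q + suc u
      shifted = subst₂ (λ m k → count First? (L + a) + repeats (a + P) ≤ repeats m + k)
                  L+a+P≡n (count-nth 1+u≤R) (count-shift First? (¬? ∘ First?) a P L first⇒repeat)
      R+p≤ : R + p ≤ Q + suc u + P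
      R+p≤ = begin
        R + p                                         ≡⟨ cong (λ m → count First? m + p) (trans (sym L+a+P≡n) (+-comm (L + a) P)) ⟩
        count First? (P + (L + a)) + p
          ≤⟨ +-mono-≤ (count[d+x]≤d+count[x] First? P (L + a)) (count-mono (¬? ∘ First?) (m≤m+n a P)) ⟩
        P + count First? (L + a) + repeats (a + P)    ≡⟨ +-assoc P _ _ ⟩
        P + (count First? (L + a) + repeats (a + P))  ≤⟨ +-monoʳ-≤ P shifted ⟩
        P + (Q + suc u)                               ≡⟨ +-comm P (Q + suc u) ⟩
        Q + suc u + P                                 ∎

    solution : Σ (Fin (3 + u) → ℕ) λ x → IsSolution (3 + u) n x × AtLeastColors (3 + u) (3 + u) c x
    solution = from-gap (decidable-stable (anyUpTo? gap? (suc n)) gap-not-absent)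
      where
      from-gap : (∃ λ z → z < suc n × Gap z) →
                 Σ (Fin (3 + u) → ℕ) λ x → IsSolution (3 + u) n x × AtLeastColors (3 + u) (3 + u) c x
      from-gap (z , _ , a<z , z+P≤n , Fz , Fz+P) =
        insertAt (z ∷ β) (fromℕ (2 + u)) (z + P) ,
        insertAt-fromℕ-IsSolution (z ∷ β) (z + P) summands-range (1≤z+P , z+P≤n) refl ,
        insertAt-fromℕ-colourful (z ∷ β) (z + P) (λ i → i) (z ∷ β) (λ _ → refl)
          (injective-∷ (injective-∷ (prefix-injective 1+u≤R) (λ i → <⇒≢ (β<z i))) z+P∉summands)
          λ { zero          → Fz+P , 1≤z+P
            ; (suc zero)    → Fz , 1≤z
            ; (suc (suc i)) → prefix-first 1+u≤R i }
        where
        1≤z : 1 ≤ z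
        1≤z = ≤-trans (s≤s z≤n) a<z
        1≤z+P : 1 ≤ z + P
        1≤z+P = ≤-trans 1≤z (m≤m+n z P)
        β<z : ∀ i → β i < z
        β<z i = ≤-<-trans (β≤a i) a<z
        z<z+P : z < z + P
        z<z+P = subst (_≤ z + P) (+-comm z 1) (+-monoʳ-≤ z 1≤P)
        z+P∉summands : ∀ i → (z ∷ β) i ≢ z + P
        z+P∉summands zero    = <⇒≢ z<z+P
        z+P∉summands (suc i) = <⇒≢ (<-trans (β<z i) z<z+P)
        summands-range : All (λ x → 1 ≤ x × x ≤ n) (z ∷ β)
        summands-range zero    = 1≤z , ≤-trans (m≤m+n z P) z+P≤n
        summands-range (suc i) = prefix-range 1+u≤R i

upper-bound : ∀ u w n r → 4 ≤ 3 + u + w → u * n + tri (3 + u) + w ≤ suc u * r →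
              Property (3 + u) (3 + u + w) n r
upper-bound u       (suc w) n r _ a≤[1+u]r c exact = UpperBound.Case-m>t.solution c n u w exact a≤[1+u]r
upper-bound zero    zero    n r (s≤s (s≤s (s≤s ())))
upper-bound (suc u) zero    n r _ a≤[1+u]r c exact =
  subst (λ m → Σ (Fin m → ℕ) λ x → IsSolution m n x × AtLeastColors (4 + u) m c x)
    (sym (+-identityʳ (4 + u)))
    (UpperBound.Case-m≡t.solution c n (suc u) (s≤s z≤n) exact
      (subst (_≤ suc (suc u) * r) (+-identityʳ _) a≤[1+u]r))

m≤[1+n]*ceilDiv[m,1+n] : ∀ m n → m ≤ suc n * ceilDiv m (suc n)
m≤[1+n]*ceilDiv[m,1+n] m n = +-cancelʳ-≤ n m _ (begin
  m + n                        ≡⟨ m≡m%n+[m/n]*n (m + n) (suc n) ⟩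
  (m + n) % suc n + q * suc n  ≤⟨ +-monoˡ-≤ (q * suc n) (s≤s⁻¹ (m%n<n (m + n) (suc n))) ⟩
  n + q * suc n                ≡⟨ +-comm n (q * suc n) ⟩
  q * suc n + n                ≡⟨ cong (_+ n) (*-comm q (suc n)) ⟩
  suc n * q + n                ∎)
  where
  open ≤-Reasoning
  q : ℕ
  q = ceilDiv m (suc n)

r<ceilDiv[m,1+n]⇒[1+n]*r<m : ∀ {m n r} → r < ceilDiv m (suc n) → suc n * r < m
r<ceilDiv[m,1+n]⇒[1+n]*r<m {m} {n} {r} r<q = +-cancelʳ-≤ n _ m (begin
  suc (suc n * r) + n  ≡⟨ cong (_+ n) (+-comm 1 (suc n * r)) ⟩
  suc n * r + 1 + n    ≡⟨ +-assoc (suc n * r) 1 n ⟩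
  suc n * r + suc n    ≡⟨ +-comm (suc n * r) (suc n) ⟩
  suc n + suc n * r    ≡⟨ *-suc (suc n) r ⟨
  suc n * suc r        ≤⟨ *-monoʳ-≤ (suc n) r<q ⟩
  suc n * q            ≡⟨ *-comm (suc n) q ⟩
  q * suc n            ≤⟨ m/n*n≤m (m + n) (suc n) ⟩
  m + n                ∎)
  where
  open ≤-Reasoning
  q : ℕ
  q = ceilDiv m (suc n)

rainbow-schur-number : ∀ u w n → 4 ≤ 3 + u + w → tri (3 + u) + w ≤ n →
  IsRS (3 + u) (3 + u + w) n (ceilDiv (u * n + tri (3 + u) + w) (suc u))
rainbow-schur-number u w n 4≤m T+w≤n = 1≤r₀ , upper-bound u w n r₀ 4≤m a≤[1+u]r₀ , minimal
  where
  a r₀ : ℕ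
  a = u * n + tri (3 + u) + w
  r₀ = ceilDiv a (suc u)
  a≤[1+u]r₀ : a ≤ suc u * r₀
  a≤[1+u]r₀ = m≤[1+n]*ceilDiv[m,1+n] a u
  1≤r₀ : 1 ≤ r₀
  1≤r₀ = n≢0⇒n>0 λ r₀≡0 →
    <⇒≱ 1≤a (≤-trans a≤[1+u]r₀ (≤-reflexive (trans (cong (suc u *_) r₀≡0) (*-zeroʳ (suc u)))))
    where
    1≤a : 1 ≤ a
    1≤a = ≤-trans (≤-trans (s≤s z≤n) (3+n≤tri[3+n] u)) (≤-trans (m≤n+m _ (u * n)) (m≤m+n _ w))
  minimal : ∀ r → 1 ≤ r → r < r₀ → ¬ Property (3 + u) (3 + u + w) n r
  minimal r 1≤r r<r₀ property = <⇒≱ [1+u]r<a (subst (λ n → u * n + tri (3 + u) + w ≤ suc u * r) n≡r+e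
    (staircase-bound u w r (n ∸ r) 1≤r (subst (λ n → Property (3 + u) (3 + u + w) n r) (sym n≡r+e) property)))
    where
    [1+u]r<a : suc u * r < a
    [1+u]r<a = r<ceilDiv[m,1+n]⇒[1+n]*r<m r<r₀
    a≤[1+u]n : a ≤ suc u * n
    a≤[1+u]n = begin
      u * n + tri (3 + u) + w    ≡⟨ +-assoc (u * n) (tri (3 + u)) w ⟩
      u * n + (tri (3 + u) + w)  ≤⟨ +-monoʳ-≤ (u * n) T+w≤n ⟩
      u * n + n                  ≡⟨ +-comm (u * n) n ⟩
      suc u * n                  ∎
      where open ≤-Reasoning
    n≡r+e : r + (n ∸ r) ≡ n
    n≡r+e = m+[n∸m]≡n (*-cancelˡ-≤ (suc u) (<⇒≤ (<-≤-trans [1+u]r<a a≤[1+u]n)))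

x+[t+w]∸t≡x+w : ∀ x t w → x + (t + w) ∸ t ≡ x + w
x+[t+w]∸t≡x+w x t w = trans (cong (_∸ t) (regroup x t w)) (m+n∸n≡m (x + w) t)
  where
  regroup : ∀ x t w → x + (t + w) ≡ x + w + t
  regroup = solve-∀

theorem7 : ∀ (m t n : ℕ) → 4 ≤ m → 3 ≤ t → t ≤ m →
    (t * (t ∸ 1)) / 2 + m ∸ t ≤ n →
    IsRS t m n (ceilDiv ((t ∸ 3) * n + (t * (t ∸ 1)) / 2 + m ∸ t) (t ∸ 2))
theorem7 m t n 4≤m (s≤s (s≤s (s≤s {n = u} _))) t≤m T+w≤n with m≤n⇒∃[o]m+o≡n t≤m
... | w , refl =
  subst (λ a → IsRS t (t + w) n (ceilDiv a (suc u))) (sym (normalise (u * n)))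
    (rainbow-schur-number u w n 4≤m (subst (_≤ n) (normalise 0) T+w≤n))
  where
  normalise : ∀ x → x + t * (t ∸ 1) / 2 + (t + w) ∸ t ≡ x + tri t + w
  normalise x = trans (x+[t+w]∸t≡x+w (x + t * (t ∸ 1) / 2) t w)
                      (cong (λ T → x + T + w) (sym (tri≡n*[n∸1]/2 t)))
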